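{- Let $S$ be a numerical semigroup with multiplicity $m$ and minimal generators $m=n_0<n_1<\dots<n_k$, and let $\rho$ be an $m$-centric minimal presentation of $S$. Fix $(z,z')\in\rho$ and let $b=\varphi_S(z)$. Then for each $i\in\operatorname{supp}(z')$, we have $b-n_i\in\mathrm{Ap}(S;m)$.
   Context: A numerical semigroup is a cofinite submonoid $S$ of $(\mathbb Z_{\ge0},+)$; its multiplicity $m$ is its smallest positive element. $\mathrm{Ap}(S;m)=\{n\in S:n-m\notin S\}=\{0,a_1,\dots,a_{m-1}\}$ with $a_i\equiv i\pmod m$, $a_0=0$. Kunz nilsemigroup $N=\mathbb Z_m\cup\{\infty\}$, $\infty$ absorbing, $i\oplus j=i+j$ if $a_i+a_j=a_{i+j}$ and $\infty$ otherwise; its atoms are $p_i=n_i\bmod m$. For $u\in N$, $\mathsf Z_P(u)=\{w\in\mathbb Z_{\ge0}^k: w_1p_1\oplus\dots\oplus w_kp_k=u\}$. Factorizations: $\mathsf Z_S(n)=\{z=(z_0,\dots,z_k)\in\mathbb Z_{\ge0}^{k+1}: n=\sum_{i=0}^k z_in_i\}$, $\varphi_S(z)=\sum_{i=0}^kz_in_i$, $\operatorname{supp}(z)=\{i\in\{0,\dots,k\}: z_i>0\}$. A presentation of $S$ is a set $\rho$ of ordered pairs $(z,z')$ with $\varphi_S(z)=\varphi_S(z')$ such that the smallest congruence on $\mathbb Z_{\ge0}^{k+1}$ containing $\rho$ is $\ker\varphi_S=\{(z,z'):\varphi_S(z)=\varphi_S(z')\}$; minimal means minimal under inclusion. For $z\in\mathbb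 Z_{\ge0}^{k+1}$ write $\widehat z=(z_1,\dots,z_k)$ and $\overline z=z_1p_1+\dots+z_kp_k\in\mathbb Z_m$. A relation $(z,z')\in\rho$ is $m$-centric if $\widehat z\in\mathsf Z_P(\overline z)$, and $\rho$ is $m$-centric if all its relations are. -}

module Defs where

open import Data.Nat using (ℕ; zero; suc; _+_; _*_; _∸_; _≤_; _<_)
open import Data.Nat.DivMod using (_%_)
open import Data.Fin as Fin using (Fin)
open import Data.Vec using (Vec; []; _∷_; lookup; head; tail; zipWith; map; sum)
open import Data.List using (List; []; _∷_; _++_; replicate)
open import Data.Maybe using (Maybe; just; nothing)
open import Data.Product using (Σ; ∃; _×_; _,_)
open import Relation.Nullary using (¬_)
open import Relation.Binary.PropositionalEquality using (_≡_; _≢_)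

-- Reduction modulo m (only used with m = n₀ > 0; the m = 0 clause is a dummy).
_mod′_ : ℕ → ℕ → ℕ
x mod′ zero = x
x mod′ suc m = x % suc m

Fac : ℕ → Set
Fac k = Vec ℕ (suc k)

module _ {k : ℕ} (n : Vec ℕ (suc k)) where

  φ : Fac k → ℕ
  φ z = sum (zipWith _*_ z n)

  InS : ℕ → Set
  InS x = ∃ λ (z : Fac k) → φ z ≡ x

  record IsNumSgpMinGens : Set where
    field
      positive : 0 < head n
      increasing : ∀ (i j : Fin (suc k)) → i Fin.< j → lookup n i < lookup n j
      minimal : ∀ (i : Fin (suc k)) →
        ¬ (∃ λ (z : Fac k) → lookup z i ≡ 0 × φ z ≡ lookup n i)
      cofinite : ∃ λ (F : ℕ) → ∀ x → F ≤ x → InS x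

  m : ℕ
  m = head n

  InAp : ℕ → Set
  InAp x = InS x × (∀ y → y + m ≡ x → ¬ InS y)

  IsApery : ℕ → ℕ → Set
  IsApery i a = InAp a × a mod′ m ≡ i

  -- Kunz nilsemigroup N = ℤ_m ∪ {∞}: residues 0 ≤ i < m as 'just i', ∞ as 'nothing'.
  -- KPlus x y r  means  x ⊕ y = r.
  data KPlus : Maybe ℕ → Maybe ℕ → Maybe ℕ → Set where
    ∞ˡ : ∀ {y} → KPlus nothing y nothing
    ∞ʳ : ∀ {x} → KPlus x nothing nothing
    fin : ∀ {i j aᵢ aⱼ aᵢⱼ} → IsApery i aᵢ → IsApery j aⱼ → IsApery ((i + j) mod′ m) aᵢⱼ →
          aᵢ + aⱼ ≡ aᵢⱼ → KPlus (just i) (just j) (just ((i + j) mod′ m))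
    inf : ∀ {i j aᵢ aⱼ aᵢⱼ} → IsApery i aᵢ → IsApery j aⱼ → IsApery ((i + j) mod′ m) aᵢⱼ →
          aᵢ + aⱼ ≢ aᵢⱼ → KPlus (just i) (just j) nothing

  data KSum : List ℕ → Maybe ℕ → Set where
    nil : KSum [] (just 0)
    cons : ∀ {x xs s r} → KSum xs s → KPlus (just x) s r → KSum (x ∷ xs) r

  atoms : Vec ℕ k
  atoms = map (_mod′ m) (tail n)

  atomList : ∀ {l} → Vec ℕ l → Vec ℕ l → List ℕ
  atomList [] [] = []
  atomList (w ∷ ws) (p ∷ ps) = replicate w p ++ atomList ws ps

  ZP : Vec ℕ k → Maybe ℕ → Set
  ZP w u = KSum (atomList w atoms) u

  zbar : Fac k → ℕ
  zbar z = sum (zipWith _*_ (tail z) atoms) mod′ m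

  data CongClo (ρ : Fac k → Fac k → Set) : Fac k → Fac k → Set where
    base : ∀ {z z'} → ρ z z' → CongClo ρ z z'
    refl′ : ∀ {z} → CongClo ρ z z
    sym′ : ∀ {z z'} → CongClo ρ z z' → CongClo ρ z' z
    trans′ : ∀ {z z' z''} → CongClo ρ z z' → CongClo ρ z' z'' → CongClo ρ z z''
    plus : ∀ {z z'} (w : Fac k) → CongClo ρ z z' →
           CongClo ρ (zipWith _+_ z w) (zipWith _+_ z' w)

  IsPresentation : (Fac k → Fac k → Set) → Set
  IsPresentation ρ =
    (∀ z z' → ρ z z' → φ z ≡ φ z') ×
    (∀ z z' → CongClo ρ z z' → φ z ≡ φ z') ×
    (∀ z z' → φ z ≡ φ z' → CongClo ρ z z')

  IsMinimalPresentation : (Fac k → Fac k → Set) → Set₁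
  IsMinimalPresentation ρ =
    IsPresentation ρ ×
    (∀ (ρ' : Fac k → Fac k → Set) → (∀ z z' → ρ' z z' → ρ z z') →
       IsPresentation ρ' → ∀ z z' → ρ z z' → ρ' z z')

  IsMCentric : (Fac k → Fac k → Set) → Set
  IsMCentric ρ = ∀ z z' → ρ z z' → ZP (tail z) (just (zbar z))

-- Write b = φ(z) and let nᵢ be a generator used by z'; clearly b − nᵢ ∈ S, so suppose that
-- y = b − nᵢ − m ∈ S. If z uses m, a factorization of y extended by nᵢ resp. m factors b − m resp.
-- b − nᵢ, which z resp. z' also factor after removing one m resp. nᵢ; everything lives below b,
-- so z and z' are connected by the other relations of ρ, contradicting minimality. Otherwise
-- z₀ = 0 and m-centricity says the Apéry elements of the atoms used by z add up in the Kunz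
-- nilsemigroup, so b is itself an Apéry element and b − m = y + nᵢ ∉ S.
module Submission where

open import Defs
open import Data.Nat using (ℕ; suc; _<_; _∸_)
open import Data.Fin using (Fin)
open import Data.Vec using (Vec; lookup)

open import Data.Nat using (zero; pred; _+_; _*_; _≤_; z≤n; s≤s; _≟_; _/_; _%_; NonZero)
open import Data.Nat.Properties
open import Algebra.Properties.CommutativeSemigroup +-commutativeSemigroup
  using (interchange; xy∙z≈xz∙y)
open import Data.Nat.DivMod using (m≡m%n+[m/n]*n; /-monoˡ-≤)
open import Data.Fin using () renaming (zero to fzero; suc to fsuc)
open import Data.Vec using ([]; _∷_; replicate; zipWith; sum; map)
open import Data.Vec.Properties using (≡-dec; lookup-zipWith; lookup-replicate)
open import Data.Vec.Relation.Binary.Pointwise.Inductive using (Pointwise-≡⇒≡; zipWith-identityʳ)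
import Data.List as List
open import Data.List.Properties using (map-++; map-replicate)
open import Data.Nat.ListAction using () renaming (sum to sumList)
open import Data.Nat.ListAction.Properties using (sum-++)
open import Data.List.Relation.Unary.All using (All; []; _∷_)
open import Data.List.Relation.Unary.All.Properties using (++⁺; replicate⁺)
open import Data.Maybe using (just)
open import Data.Product using (∃; _×_; _,_; proj₁; proj₂)
open import Data.Sum using (inj₁; inj₂)
open import Data.Empty using (⊥; ⊥-elim)
open import Function using (_∘_)
open import Relation.Nullary using (¬_; yes; no)
open import Relation.Binary.PropositionalEquality

private variable l : ℕ

≡-mod∧≤⇒≡+multiple : ∀ {x a} d .{{_ : NonZero d}} → x % d ≡ a % d → x ≤ a →
                      ∃ λ t → a ≡ x + t * d
≡-mod∧≤⇒≡+multiple {x} {a} d x≡a x≤a = t , (begin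
    a                                  ≡⟨ m≡m%n+[m/n]*n a d ⟩
    a % d + (a / d) * d                ≡⟨ cong₂ (λ r q → r + q * d) (sym x≡a)
                                                      (sym (m+[n∸m]≡n x/d≤a/d)) ⟩
    x % d + (x / d + t) * d            ≡⟨ cong (x % d +_) (*-distribʳ-+ d (x / d) t) ⟩
    x % d + ((x / d) * d + t * d)      ≡⟨ sym (+-assoc (x % d) ((x / d) * d) (t * d)) ⟩
    (x % d + (x / d) * d) + t * d      ≡⟨ cong (_+ t * d) (sym (m≡m%n+[m/n]*n x d)) ⟩
    x + t * d                          ∎)
  where
  open ≡-Reasoning
  t : ℕ
  t = a / d ∸ x / d
  x/d≤a/d : x / d ≤ a / d
  x/d≤a/d = /-monoˡ-≤ d x≤a

infixl 6 _⊕_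
_⊕_ : Vec ℕ l → Vec ℕ l → Vec ℕ l
_⊕_ = zipWith _+_

unit : Fin l → Vec ℕ l
unit {suc l} fzero = 1 ∷ replicate l 0
unit (fsuc j) = 0 ∷ unit j

dot : Vec ℕ l → Vec ℕ l → ℕ
dot z g = sum (zipWith _*_ z g)

⊕-identityʳ : (a : Vec ℕ l) → a ⊕ replicate l 0 ≡ a
⊕-identityʳ a = Pointwise-≡⇒≡ (zipWith-identityʳ +-identityʳ a)

⊕-swapʳ : (a b c : Vec ℕ l) → a ⊕ b ⊕ c ≡ a ⊕ c ⊕ b
⊕-swapʳ [] [] [] = refl
⊕-swapʳ (x ∷ a) (y ∷ b) (w ∷ c) = cong₂ _∷_ (xy∙z≈xz∙y x y w) (⊕-swapʳ a b c)

_−unit_ : Vec ℕ l → Fin l → Vec ℕ l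
(c ∷ z) −unit fzero = pred c ∷ z
(c ∷ z) −unit fsuc j = c ∷ (z −unit j)

−unit⊕unit : (z : Vec ℕ l) (j : Fin l) → 0 < lookup z j → z −unit j ⊕ unit j ≡ z
−unit⊕unit (suc c ∷ z) fzero _ = cong₂ _∷_ (+-comm c 1) (⊕-identityʳ z)
−unit⊕unit (c ∷ z) (fsuc j) 0<zⱼ = cong₂ _∷_ (+-identityʳ c) (−unit⊕unit z j 0<zⱼ)

dot-⊕ : (a b g : Vec ℕ l) → dot (a ⊕ b) g ≡ dot a g + dot b g
dot-⊕ [] [] [] = refl
dot-⊕ (x ∷ a) (y ∷ b) (c ∷ g) =
  trans (cong₂ _+_ (*-distribʳ-+ c x y) (dot-⊕ a b g)) (interchange (x * c) (y * c) (dot a g) (dot b g))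

dot-zeros : (g : Vec ℕ l) → dot (replicate l 0) g ≡ 0
dot-zeros [] = refl
dot-zeros (c ∷ g) = dot-zeros g

dot-unit : (j : Fin l) (g : Vec ℕ l) → dot (unit j) g ≡ lookup g j
dot-unit fzero (c ∷ g) = trans (cong₂ _+_ (+-identityʳ c) (dot-zeros g)) (+-identityʳ c)
dot-unit (fsuc j) (c ∷ g) = dot-unit j g

generator-positive : ∀ {k} {n : Vec ℕ (suc k)} → IsNumSgpMinGens n → ∀ i → 0 < lookup n i
generator-positive {n = _ ∷ _} gens fzero = IsNumSgpMinGens.positive gens
generator-positive {n = _ ∷ _} gens (fsuc j) =
  <-trans (IsNumSgpMinGens.positive gens) (IsNumSgpMinGens.increasing gens fzero (fsuc j) (s≤s z≤n))

module _ {k : ℕ} (n : Vec ℕ (suc k)) where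

  φ-⊕-unit : ∀ u j → φ n (u ⊕ unit j) ≡ φ n u + lookup n j
  φ-⊕-unit u j = trans (dot-⊕ u (unit j) n) (cong (φ n u +_) (dot-unit j n))

  φ[−unit]+n≡φ : ∀ z j → 0 < lookup z j → φ n (z −unit j) + lookup n j ≡ φ n z
  φ[−unit]+n≡φ z j 0<zⱼ =
    trans (sym (φ-⊕-unit (z −unit j) j)) (cong (φ n) (−unit⊕unit z j 0<zⱼ))

  InS-zero : InS n 0
  InS-zero = replicate (suc k) 0 , dot-zeros n

  InS-+ : ∀ {x y} → InS n x → InS n y → InS n (x + y)
  InS-+ (a , φa≡x) (b , φb≡y) = a ⊕ b , trans (dot-⊕ a b n) (cong₂ _+_ φa≡x φb≡y)

  InS-generator : ∀ j → InS n (lookup n j)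
  InS-generator j = unit j , dot-unit j n

  InS-multiple : ∀ j t → InS n (t * lookup n j)
  InS-multiple j zero = InS-zero
  InS-multiple j (suc t) = InS-+ (InS-generator j) (InS-multiple j t)

  atomList-map : ∀ (f : ℕ → ℕ) (w gs : Vec ℕ l) →
                 atomList n w (map f gs) ≡ List.map f (atomList n w gs)
  atomList-map f [] [] = refl
  atomList-map f (c ∷ w) (g ∷ gs) =
    trans (cong₂ List._++_ (sym (map-replicate f c g)) (atomList-map f w gs))
          (sym (map-++ f (List.replicate c g) (atomList n w gs)))

  sum-atomList : (w gs : Vec ℕ l) → sumList (atomList n w gs) ≡ dot w gs
  sum-atomList [] [] = refl
  sum-atomList (c ∷ w) (g ∷ gs) =
    trans (sum-++ (List.replicate c g) (atomList n w gs)) (cong₂ _+_ (sum-replicate c) (sum-atomList w gs))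
    where
    sum-replicate : ∀ c → sumList (List.replicate c g) ≡ c * g
    sum-replicate zero = refl
    sum-replicate (suc c) = cong (g +_) (sum-replicate c)

  atomList-All : ∀ {P : ℕ → Set} (w gs : Vec ℕ l) → (∀ j → P (lookup gs j)) →
                 All P (atomList n w gs)
  atomList-All [] [] _ = []
  atomList-All (c ∷ w) (g ∷ gs) P-gs =
    ++⁺ (replicate⁺ c (P-gs fzero)) (atomList-All w gs (P-gs ∘ fsuc))

  without : (Fac k → Fac k → Set) → Fac k → Fac k → Fac k → Fac k → Set
  without ρ z z' a a' = ρ a a' × ¬ (a ≡ z × a' ≡ z')

  CongClo-bind : ∀ {ρ σ : Fac k → Fac k → Set} → (∀ {a a'} → ρ a a' → CongClo n σ a a') →
                 ∀ {a a'} → CongClo n ρ a a' → CongClo n σ a a'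
  CongClo-bind f (base r) = f r
  CongClo-bind f refl′ = refl′
  CongClo-bind f (sym′ d) = sym′ (CongClo-bind f d)
  CongClo-bind f (trans′ d e) = trans′ (CongClo-bind f d) (CongClo-bind f e)
  CongClo-bind f (plus w d) = plus w (CongClo-bind f d)

  module _ {ρ : Fac k → Fac k → Set} (pres : IsPresentation n ρ) {z z' : Fac k} where

    private
      CongClo⇒φ≡ : ∀ {a a'} → CongClo n ρ a a' → φ n a ≡ φ n a'
      CongClo⇒φ≡ = proj₁ (proj₂ pres) _ _

    -- every step of a chain starting below φ(z) stays below φ(z), so never uses (z, z')
    CongClo-below : ∀ {a a'} → CongClo n ρ a a' → φ n a < φ n z → CongClo n (without ρ z z') a a'
    CongClo-below (base r) φa<b = base (r , λ { (refl , _) → <-irrefl refl φa<b })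
    CongClo-below refl′ _ = refl′
    CongClo-below (sym′ d) φa<b = sym′ (CongClo-below d (subst (_< φ n z) (sym (CongClo⇒φ≡ d)) φa<b))
    CongClo-below (trans′ d e) φa<b =
      trans′ (CongClo-below d φa<b) (CongClo-below e (subst (_< φ n z) (CongClo⇒φ≡ d) φa<b))
    CongClo-below (plus {z = a} w d) φa+w<b = plus w (CongClo-below d φa<b)
      where
      φa<b : φ n a < φ n z
      φa<b = ≤-<-trans (m≤m+n (φ n a) (φ n w)) (subst (_< φ n z) (dot-⊕ a w n) φa+w<b)

    redundant⇒presentation : CongClo n (without ρ z z') z z' → IsPresentation n (without ρ z z')
    redundant⇒presentation z~z' =
      (λ a a' r → proj₁ pres a a' (proj₁ r)) ,
      (λ a a' d → proj₁ (proj₂ pres) a a' (CongClo-bind (base ∘ proj₁) d)) ,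
      (λ a a' φa≡φa' → CongClo-bind replace (proj₂ (proj₂ pres) a a' φa≡φa'))
      where
      replace : ∀ {a a'} → ρ a a' → CongClo n (without ρ z z') a a'
      replace {a} {a'} r with ≡-dec _≟_ a z | ≡-dec _≟_ a' z'
      ... | yes refl | yes refl = z~z'
      ... | no a≢z | _ = base (r , λ p → a≢z (proj₁ p))
      ... | yes _ | no a'≢z' = base (r , λ p → a'≢z' (proj₂ p))

  minimal⇒non-redundant : ∀ {ρ} → IsMinimalPresentation n ρ → ∀ {z z'} → ρ z z' →
                          ¬ CongClo n (without ρ z z') z z'
  minimal⇒non-redundant (pres , minimal) zρz' z~z' =
    proj₂ (minimal _ (λ _ _ → proj₁) (redundant⇒presentation pres z~z') _ _ zρz') (refl , refl)

  -- With y = φ(v), both z = (z − eⱼ) + eⱼ and z' = (z' − eᵢ) + eᵢ connect below φ(z) to v + eᵢ + eⱼ.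
  minimal⇒[φ∸nⱼ∸nᵢ]∉S : ∀ {ρ} → IsMinimalPresentation n ρ → ∀ {z z'} → ρ z z' →
    ∀ j i → 0 < lookup z j → 0 < lookup z' i → 0 < lookup n j → 0 < lookup n i →
    ∀ {y} → InS n y → y + lookup n j + lookup n i ≡ φ n z → ⊥
  minimal⇒[φ∸nⱼ∸nᵢ]∉S min@(pres , _) {z} {z'} zρz' j i 0<zⱼ 0<z'ᵢ 0<nⱼ 0<nᵢ {y} (v , φv≡y)
                       y+nⱼ+nᵢ≡b =
    minimal⇒non-redundant min zρz' (trans′ z~w w~z')
    where
    nⱼ nᵢ b : ℕ
    nⱼ = lookup n j
    nᵢ = lookup n i
    b = φ n z
    φu+nⱼ≡b : φ n (z −unit j) + nⱼ ≡ b
    φu+nⱼ≡b = φ[−unit]+n≡φ z j 0<zⱼ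
    φu'+nᵢ≡b : φ n (z' −unit i) + nᵢ ≡ b
    φu'+nᵢ≡b = trans (φ[−unit]+n≡φ z' i 0<z'ᵢ) (sym (proj₁ pres z z' zρz'))
    φ[v+eᵢ]+nⱼ≡b : φ n (v ⊕ unit i) + nⱼ ≡ b
    φ[v+eᵢ]+nⱼ≡b = trans (cong (_+ nⱼ) (trans (φ-⊕-unit v i) (cong (_+ nᵢ) φv≡y)))
                         (trans (xy∙z≈xz∙y y nᵢ nⱼ) y+nⱼ+nᵢ≡b)
    φ[v+eⱼ]+nᵢ≡b : φ n (v ⊕ unit j) + nᵢ ≡ b
    φ[v+eⱼ]+nᵢ≡b =
      trans (cong (_+ nᵢ) (trans (φ-⊕-unit v j) (cong (_+ nⱼ) φv≡y))) y+nⱼ+nᵢ≡b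
    φ≡⇒CongClo : ∀ {a a'} → φ n a ≡ φ n a' → CongClo n _ a a'
    φ≡⇒CongClo = proj₂ (proj₂ pres) _ _
    below : ∀ {x c} → x + c ≡ b → 0 < c → x < b
    below {x} x+c≡b 0<c = subst (x <_) x+c≡b (m<m+n x 0<c)
    z~w : CongClo n (without _ z z') z (v ⊕ unit j ⊕ unit i)
    z~w = subst₂ (CongClo n (without _ z z')) (−unit⊕unit z j 0<zⱼ) (⊕-swapʳ v (unit i) (unit j))
            (plus (unit j) (CongClo-below pres
              (φ≡⇒CongClo (+-cancelʳ-≡ nⱼ _ _ (trans φu+nⱼ≡b (sym φ[v+eᵢ]+nⱼ≡b))))
              (below φu+nⱼ≡b 0<nⱼ)))
    w~z' : CongClo n (without _ z z') (v ⊕ unit j ⊕ unit i) z'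
    w~z' = subst (CongClo n (without _ z z') _) (−unit⊕unit z' i 0<z'ᵢ)
             (plus (unit i) (CongClo-below pres
               (φ≡⇒CongClo (+-cancelʳ-≡ nᵢ _ _ (trans φ[v+eⱼ]+nᵢ≡b (sym φu'+nᵢ≡b))))
               (below φ[v+eⱼ]+nᵢ≡b 0<nᵢ)))

module Apery {k : ℕ} (m₀ : ℕ) (ns : Vec ℕ k) where

  private
    M : ℕ
    M = suc m₀
    n : Vec ℕ (suc k)
    n = M ∷ ns

  InS⇒¬InAp[+multiple] : ∀ {x} t → InS n x → ¬ InAp n (x + suc t * M)
  InS⇒¬InAp[+multiple] {x} t x∈S (_ , noPredecessor) =
    noPredecessor (x + t * M) (trans (+-assoc x (t * M) M) (cong (x +_) (+-comm (t * M) M)))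
      (InS-+ n x∈S (InS-multiple n fzero t))

  Apery-≤⇒≡ : ∀ {r a a'} → IsApery n r a → IsApery n r a' → a ≤ a' → a ≡ a'
  Apery-≤⇒≡ {a = a} ((a∈S , _) , a≡r) (a'∈Ap , a'≡r) a≤a'
    with ≡-mod∧≤⇒≡+multiple M (trans a≡r (sym a'≡r)) a≤a'
  ... | zero , a'≡a+0 = sym (trans a'≡a+0 (+-identityʳ a))
  ... | suc t , a'≡a+tm = ⊥-elim (InS⇒¬InAp[+multiple] t a∈S (subst (InAp n) a'≡a+tm a'∈Ap))

  Apery-unique : ∀ {r a a'} → IsApery n r a → IsApery n r a' → a ≡ a'
  Apery-unique {a = a} {a'} ap ap' with ≤-total a a'
  ... | inj₁ a≤a' = Apery-≤⇒≡ ap ap' a≤a'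
  ... | inj₂ a'≤a = sym (Apery-≤⇒≡ ap' ap a'≤a)

  KSum⇒IsApery : ∀ {G r} → All (InAp n) G → KSum n (List.map (_% M) G) (just r) →
                 IsApery n r (sumList G)
  KSum⇒IsApery [] nil = (InS-zero n , λ y y+m≡0 _ → 0≢1+n (trans (sym y+m≡0) (+-comm y M))) , refl
  KSum⇒IsApery {g List.∷ G} (g∈Ap ∷ G⊆Ap) (cons {s = just j} sumG (fin apᵢ apⱼ apᵢⱼ aᵢ+aⱼ≡aᵢⱼ)) =
    subst (IsApery n _)
      (trans (sym aᵢ+aⱼ≡aᵢⱼ)
             (cong₂ _+_ (Apery-unique apᵢ (g∈Ap , refl)) (Apery-unique apⱼ (KSum⇒IsApery G⊆Ap sumG))))
      apᵢⱼ

  generator∈Ap : IsNumSgpMinGens n → ∀ j → InAp n (lookup ns j)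
  generator∈Ap gens j = InS-generator n (fsuc j) , noPredecessor
    where
    noPredecessor : ∀ y → y + M ≡ lookup ns j → ¬ InS n y
    noPredecessor y y+m≡nⱼ (v , φv≡y) with lookup v (fsuc j) in vⱼ≡
    ... | zero = IsNumSgpMinGens.minimal gens (fsuc j)
          ( v ⊕ unit fzero
          , trans (lookup-zipWith _+_ (fsuc j) v (unit fzero)) (cong₂ _+_ vⱼ≡ (lookup-replicate j 0))
          , trans (φ-⊕-unit n v fzero) (trans (cong (_+ M) φv≡y) y+m≡nⱼ))
    ... | suc _ = <-irrefl refl (begin-strict
              lookup ns j                       ≤⟨ m≤n+m (lookup ns j) (φ n (v −unit fsuc j)) ⟩
              φ n (v −unit fsuc j) + lookup ns j ≡⟨ φ[−unit]+n≡φ n v (fsuc j) 0<vⱼ ⟩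
              φ n v                             ≡⟨ φv≡y ⟩
              y                                 <⟨ m<m+n y (s≤s z≤n) ⟩
              y + M                             ≡⟨ y+m≡nⱼ ⟩
              lookup ns j                       ∎)
      where
      open ≤-Reasoning
      0<vⱼ : 0 < lookup v (fsuc j)
      0<vⱼ = subst (0 <_) (sym vⱼ≡) (s≤s z≤n)

  ZP⇒InAp : IsNumSgpMinGens n → ∀ w {r} → ZP n w (just r) → InAp n (φ n (0 ∷ w))
  ZP⇒InAp gens w {r} w∈ZP = subst (InAp n) (sum-atomList n w ns)
    (proj₁ (KSum⇒IsApery (atomList-All n w ns (generator∈Ap gens))
                         (subst (λ xs → KSum n xs (just r)) (atomList-map n (_% M) w ns) w∈ZP)))

  centric∧z₀≡0⇒InAp : IsNumSgpMinGens n → ∀ {ρ} → IsMCentric n ρ → ∀ {z z'} → ρ z z' →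
                      lookup z fzero ≡ 0 → InAp n (φ n z)
  centric∧z₀≡0⇒InAp gens centric {zero ∷ w} zρz' refl = ZP⇒InAp gens w (centric _ _ zρz')

lemma5p11 : ∀ {k : ℕ} (n : Vec ℕ (suc k)) → IsNumSgpMinGens n →
    (ρ : Fac k → Fac k → Set) → IsMinimalPresentation n ρ → IsMCentric n ρ →
    ∀ (z z' : Fac k) → ρ z z' →
    ∀ (i : Fin (suc k)) → 0 < lookup z' i →
    InAp n (φ n z ∸ lookup n i)
lemma5p11 (zero ∷ _) gens with IsNumSgpMinGens.positive gens
... | ()
lemma5p11 n@(suc m₀ ∷ ns) gens ρ min centric z z' zρz' i 0<z'ᵢ = (u' , b∸nᵢ≡φu') , noPredecessor
  where
  open Apery m₀ ns
  nᵢ : ℕ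
  nᵢ = lookup n i
  u' : Fac _
  u' = z' −unit i
  φu'+nᵢ≡b : φ n u' + nᵢ ≡ φ n z
  φu'+nᵢ≡b = trans (φ[−unit]+n≡φ n z' i 0<z'ᵢ) (sym (proj₁ (proj₁ min) z z' zρz'))
  b∸nᵢ≡φu' : φ n u' ≡ φ n z ∸ nᵢ
  b∸nᵢ≡φu' = trans (sym (m+n∸n≡m (φ n u') nᵢ)) (cong (_∸ nᵢ) φu'+nᵢ≡b)
  nᵢ≤b : nᵢ ≤ φ n z
  nᵢ≤b = subst (nᵢ ≤_) φu'+nᵢ≡b (m≤n+m nᵢ (φ n u'))
  noPredecessor : ∀ y → y + suc m₀ ≡ φ n z ∸ nᵢ → ¬ InS n y
  noPredecessor y y+m≡b∸nᵢ y∈S = excluded (trans (cong (_+ nᵢ) y+m≡b∸nᵢ) (m∸n+n≡m nᵢ≤b))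
    where
    excluded : y + suc m₀ + nᵢ ≡ φ n z → ⊥
    excluded y+m+nᵢ≡b with lookup z fzero in z₀≡
    ... | zero = proj₂ (centric∧z₀≡0⇒InAp gens centric zρz' z₀≡) (y + nᵢ)
                   (trans (xy∙z≈xz∙y y nᵢ (suc m₀)) y+m+nᵢ≡b) (InS-+ n y∈S (InS-generator n i))
    ... | suc _ = minimal⇒[φ∸nⱼ∸nᵢ]∉S n min zρz' fzero i (subst (0 <_) (sym z₀≡) (s≤s z≤n)) 0<z'ᵢ
                    (s≤s z≤n) (generator-positive gens i) y∈S y+m+nᵢ≡b
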